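{- Let $f\colon X\to Y$ be a morphism in $\mathbf{OMLatGal}$, and let $a\in X$, $b\in Y$. Then, as kernel subobjects, $f^{ -1}(b\colon{\downarrow}b\to Y)=(f^*(b^\perp)\colon{\downarrow}f^*(b^\perp)\to X)$ and $\exists_f(a\colon{\downarrow}a\to X)=(f_*(a)^\perp\colon{\downarrow}(f_*(a)^\perp)\to Y)$.
   Context: An orthomodular lattice is a bounded lattice with orthocomplement $x\mapsto x^\perp$ ($x^{\perp\perp}=x$, order-reversing, $x\wedge x^\perp=0$) with $x\le y\Rightarrow y=x\vee(x^\perp\wedge y)$. $\mathbf{OMLatGal}$: objects orthomodular lattices; morphisms $f\colon X\to Y$ pairs $(f_*,f^*)$ of order-reversing maps with $x\le f^*(y)\iff y\le f_*(x)$; identity $((-)^\perp,(-)^\perp)$; composition $(g\circ f)_*=g_*\circ(-)^\perp\circ f_*$, $(g\circ f)^*=f^*\circ(-)^\perp\circ g^*$; dagger $(f_*,f^*)^\dagger=(f^*,f_*)$. For $c\in Z$, ${\downarrow}c=\{u\le c\}$ with orthocomplement $u\mapsto c\wedge u^\perp$ and $c\colon{\downarrow}c\to Z$ denotes the morphism $c_*(u)=u^\perp$, $c^*(z)=c\wedge z^\perp$. $\mathbf{OMLatGal}$ is a dagger kernel category with the kernel of $g$ given by $k\colon{\downarrow}k\to X$ with $k=g^*(1)$. With $\mathrm{coker}(g)=\ker(g^\dagger)^\dagger$, inverse image and direct image are defined by $f^{ -1}(n)=\ker(\mathrm{coker}(n)\circ f)$ and $\exists_f(m)=\ker(\mathrm{coker}(f\circ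 m))$, with kernels compared as subobjects (up to isomorphism). -}

module Defs where

open import Level using (Level; _⊔_; suc)
open import Data.Product using (Σ; _,_; proj₁; proj₂; _×_)
open import Relation.Binary.Core using (Rel)
open import Relation.Binary.Lattice.Bundles using (BoundedLattice)

record OML (c ℓ₁ ℓ₂ : Level) : Set (suc (c ⊔ ℓ₁ ⊔ ℓ₂)) where
  field
    boundedLattice : BoundedLattice c ℓ₁ ℓ₂
  open BoundedLattice boundedLattice public
  infix 9 _ᶜ
  field
    _ᶜ         : Carrier → Carrier
    ᶜ-invol    : ∀ x → (x ᶜ) ᶜ ≈ x
    ᶜ-antitone : ∀ {x y} → x ≤ y → y ᶜ ≤ x ᶜ
    ᶜ-meet     : ∀ x → (x ∧ x ᶜ) ≈ ⊥
    orthomod   : ∀ {x y} → x ≤ y → y ≈ (x ∨ ((x ᶜ) ∧ y))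

-- The data of an object of OMLatGal that is used by the category
-- structure (composition, identity, kernels): carrier, equality,
-- order, top, orthocomplement.

record OStr (a e r : Level) : Set (suc (a ⊔ e ⊔ r)) where
  infix 4 _≈_ _≤_
  infix 9 _ᶜ
  field
    Carrier : Set a
    _≈_     : Rel Carrier e
    _≤_     : Rel Carrier r
    top     : Carrier
    _ᶜ      : Carrier → Carrier

obj : ∀ {c ℓ₁ ℓ₂} → OML c ℓ₁ ℓ₂ → OStr c ℓ₁ ℓ₂
obj X = record
  { Carrier = Carrier ; _≈_ = _≈_ ; _≤_ = _≤_ ; top = ⊤ ; _ᶜ = _ᶜ }
  where open OML X

Down : ∀ {c ℓ₁ ℓ₂} (X : OML c ℓ₁ ℓ₂) → OML.Carrier X → OStr (c ⊔ ℓ₂) ℓ₁ ℓ₂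
Down X k = record
  { Carrier = Σ Carrier (λ u → u ≤ k)
  ; _≈_ = λ u v → proj₁ u ≈ proj₁ v
  ; _≤_ = λ u v → proj₁ u ≤ proj₁ v
  ; top = k , refl
  ; _ᶜ = λ u → (k ∧ (proj₁ u) ᶜ) , x∧y≤x k ((proj₁ u) ᶜ)
  }
  where open OML X

-- Morphisms of OMLatGal.  'Raw' is the underlying pair of maps
-- (f_* = push, f^* = pull); 'Gal' adds the defining conditions.

module _ {a₁ e₁ r₁ a₂ e₂ r₂}
         (A : OStr a₁ e₁ r₁) (B : OStr a₂ e₂ r₂) where
  private
    module A = OStr A
    module B = OStr B

  record Raw : Set (a₁ ⊔ a₂) where
    field
      push : A.Carrier → B.Carrier
      pull : B.Carrier → A.Carrier

  record Gal : Set (a₁ ⊔ a₂ ⊔ r₁ ⊔ r₂) where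
    field
      raw : Raw
    open Raw raw public
    field
      push-antitone : ∀ {x x'} → x A.≤ x' → push x' B.≤ push x
      pull-antitone : ∀ {y y'} → y B.≤ y' → pull y' A.≤ pull y
      galois        : ∀ x y → (x A.≤ pull y → y B.≤ push x)
                             × (y B.≤ push x → x A.≤ pull y)

  _≋_ : Raw → Raw → Set (a₁ ⊔ a₂ ⊔ e₁ ⊔ e₂)
  f ≋ g = (∀ x → Raw.push f x B.≈ Raw.push g x)
        × (∀ y → Raw.pull f y A.≈ Raw.pull g y)

open Raw public

_∘ᴳ_ : ∀ {a₁ e₁ r₁ a₂ e₂ r₂ a₃ e₃ r₃}
         {A : OStr a₁ e₁ r₁} {B : OStr a₂ e₂ r₂} {C : OStr a₃ e₃ r₃} →
       Raw B C → Raw A B → Raw A C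
_∘ᴳ_ {B = B} g f = record
  { push = λ x → push g (push f x ᶜ)
  ; pull = λ z → pull f (pull g z ᶜ) }
  where open OStr B

_† : ∀ {a₁ e₁ r₁ a₂ e₂ r₂} {A : OStr a₁ e₁ r₁} {B : OStr a₂ e₂ r₂} →
     Raw A B → Raw B A
f † = record { push = pull f ; pull = push f }

incl : ∀ {c ℓ₁ ℓ₂} (X : OML c ℓ₁ ℓ₂) (k : OML.Carrier X) →
       Raw (Down X k) (obj X)
incl X k = record
  { push = λ u → proj₁ u ᶜ
  ; pull = λ z → (k ∧ z ᶜ) , x∧y≤x k (z ᶜ) }
  where open OML X

kerElt : ∀ {c ℓ₁ ℓ₂ a e r} (X : OML c ℓ₁ ℓ₂) {B : OStr a e r} →
         Raw (obj X) B → OML.Carrier X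
kerElt X {B} g = pull g (OStr.top B)

ker : ∀ {c ℓ₁ ℓ₂ a e r} (X : OML c ℓ₁ ℓ₂) {B : OStr a e r} →
      (g : Raw (obj X) B) → Raw (Down X (kerElt X g)) (obj X)
ker X g = incl X (kerElt X g)

coker : ∀ {c ℓ₁ ℓ₂ a e r} (Y : OML c ℓ₁ ℓ₂) {A : OStr a e r} →
        (g : Raw A (obj Y)) → Raw (obj Y) (Down Y (kerElt Y (g †)))
coker Y g = ker Y (g †) †

inv : ∀ {c ℓ₁ ℓ₂ c' ℓ₁' ℓ₂' a e r}
        (X : OML c ℓ₁ ℓ₂) (Y : OML c' ℓ₁' ℓ₂') {A : OStr a e r} →
      (f : Raw (obj X) (obj Y)) → (n : Raw A (obj Y)) →
      Raw (Down X (kerElt X (coker Y n ∘ᴳ f))) (obj X)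
inv X Y f n = ker X (coker Y n ∘ᴳ f)

img : ∀ {c ℓ₁ ℓ₂ c' ℓ₁' ℓ₂' a e r}
        (X : OML c ℓ₁ ℓ₂) (Y : OML c' ℓ₁' ℓ₂') {A : OStr a e r} →
      (f : Raw (obj X) (obj Y)) → (m : Raw A (obj X)) →
      Raw (Down Y (kerElt Y (coker Y (f ∘ᴳ m)))) (obj Y)
img X Y f m = ker Y (coker Y (f ∘ᴳ m))

SubLe : ∀ {c ℓ₁ ℓ₂ a e r a' e' r'} (Z : OML c ℓ₁ ℓ₂)
          {A : OStr a e r} {A' : OStr a' e' r'} →
        Raw A (obj Z) → Raw A' (obj Z) → Set _
SubLe Z {A} {A'} m n = Σ (Gal A A') (λ φ → _≋_ A (obj Z) (n ∘ᴳ Gal.raw φ) m)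

SubEq : ∀ {c ℓ₁ ℓ₂ a e r a' e' r'} (Z : OML c ℓ₁ ℓ₂)
          {A : OStr a e r} {A' : OStr a' e' r'} →
        Raw A (obj Z) → Raw A' (obj Z) → Set _
SubEq Z m n = SubLe Z m n × SubLe Z n m

module Submission where

-- Every kernel in OMLatGal is, up to the name of its carrier, an inclusion
-- c : ↓c → Z of a down-set.  Unfolding the definitions, the inverse image
-- f⁻¹(b) is the kernel ↓k → X with k = f^*(((bᶜ)ᶜ)ᶜ), and the direct image
-- ∃_f(a) is the kernel ↓k → Y with k = (f_*((aᶜ)ᶜ))ᶜ.  So the theorem follows
-- from two facts:
--   (1) the kernel elements agree with f^*(bᶜ) and f_*(a)ᶜ up to ≈, because
--       ᶜ is an involution and antitone maps respect ≈;
--   (2) the inclusion c : ↓c → Z depends on c only up to ≈ as a subobject.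
-- For (2) we show more generally that c₁ ≤ c₂ makes c₁ factor through c₂,
-- via the morphism ↓c₁ → ↓c₂ built from the relative orthocomplements
-- u ↦ c ∧ uᶜ.  That this factorisation commutes rests on orthomodularity,
-- which makes the relative orthocomplement of ↓c an involution.

open import Defs
open import Data.Product using (_×_; _,_; proj₁; proj₂)
open import Relation.Binary.Bundles using (Poset)
import Relation.Binary.Lattice.Properties.MeetSemilattice as MeetProperties
import Relation.Binary.Reasoning.Setoid as SetoidReasoning

antitone-cong : ∀ {a e r a' e' r'} (P : Poset a e r) (Q : Poset a' e' r')
                (h : Poset.Carrier P → Poset.Carrier Q) →
                (∀ {x y} → Poset._≤_ P x y → Poset._≤_ Q (h y) (h x)) →
                ∀ {x y} → Poset._≈_ P x y → Poset._≈_ Q (h x) (h y)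
antitone-cong P Q h anti x≈y =
  Q.antisym (anti (P.reflexive (P.Eq.sym x≈y))) (anti (P.reflexive x≈y))
  where
  module P = Poset P
  module Q = Poset Q

module OrthoLattice {c ℓ₁ ℓ₂} (X : OML c ℓ₁ ℓ₂) where
  open OML X
  open MeetProperties meetSemilattice using (∧-cong; ∧-assoc)

  ᶜ-cong : ∀ {x y} → x ≈ y → x ᶜ ≈ y ᶜ
  ᶜ-cong = antitone-cong poset poset _ᶜ ᶜ-antitone

  ≤ᶜᶜ : ∀ {x} → x ≤ (x ᶜ) ᶜ
  ≤ᶜᶜ {x} = reflexive (Eq.sym (ᶜ-invol x))

  ᶜ-swap : ∀ {u v} → u ≤ v ᶜ → v ≤ u ᶜ
  ᶜ-swap u≤vᶜ = trans ≤ᶜᶜ (ᶜ-antitone u≤vᶜ)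

  relᶜ : Carrier → Carrier → Carrier
  relᶜ k u = k ∧ u ᶜ

  relᶜ-antitone : ∀ {k u u'} → u ≤ u' → relᶜ k u' ≤ relᶜ k u
  relᶜ-antitone u≤u' = ∧-greatest (x∧y≤x _ _) (trans (x∧y≤y _ _) (ᶜ-antitone u≤u'))

  relᶜ-galois : ∀ {k k' u v} → v ≤ k → u ≤ relᶜ k' v → v ≤ relᶜ k u
  relᶜ-galois v≤k u≤relᶜv = ∧-greatest v≤k (ᶜ-swap (trans u≤relᶜv (x∧y≤y _ _)))

  u≤relᶜ² : ∀ {u k} → u ≤ k → u ≤ relᶜ k (relᶜ k u)
  u≤relᶜ² u≤k = relᶜ-galois u≤k refl

  -- Writing t = relᶜ k u and w = relᶜ k t, we have u ≤ w, and uᶜ ∧ w lies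
  -- below t ∧ tᶜ = ⊥, so orthomodularity w ≈ u ∨ (uᶜ ∧ w) gives w ≤ u.
  relᶜ-invol : ∀ {u k} → u ≤ k → relᶜ k (relᶜ k u) ≈ u
  relᶜ-invol {u} {k} u≤k = antisym w≤u (u≤relᶜ² u≤k)
    where
    t = relᶜ k u
    w = relᶜ k t
    uᶜ∧w≤⊥ : u ᶜ ∧ w ≤ ⊥
    uᶜ∧w≤⊥ = trans (∧-greatest (∧-greatest (trans (x∧y≤y _ _) (x∧y≤x _ _)) (x∧y≤x _ _))
                                (trans (x∧y≤y _ _) (x∧y≤y _ _)))
                   (reflexive (ᶜ-meet t))
    w≤u : w ≤ u
    w≤u = trans (reflexive (orthomod (u≤relᶜ² u≤k)))
                (∨-least refl (trans uᶜ∧w≤⊥ (minimum u)))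

  -- The pull-back half of the factorisation of k₁ through k₂: taking the
  -- relative orthocomplement twice in ↓k₂ and then cutting down to ↓k₁
  -- is the same as cutting k₂ ∧ w down to ↓k₁.
  relᶜ-restrict : ∀ {k₁ k₂} → k₁ ≤ k₂ → ∀ w →
                  k₁ ∧ (relᶜ k₂ (k₂ ∧ w)) ᶜ ≈ k₁ ∧ w
  relᶜ-restrict {k₁} {k₂} k₁≤k₂ w = begin
    k₁ ∧ (relᶜ k₂ (k₂ ∧ w)) ᶜ          ≈⟨ ∧-cong k₁∧k₂≈k₁ Eq.refl ⟨
    (k₁ ∧ k₂) ∧ (relᶜ k₂ (k₂ ∧ w)) ᶜ   ≈⟨ ∧-assoc k₁ k₂ _ ⟩
    k₁ ∧ relᶜ k₂ (relᶜ k₂ (k₂ ∧ w))    ≈⟨ ∧-cong Eq.refl (relᶜ-invol (x∧y≤x k₂ w)) ⟩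
    k₁ ∧ (k₂ ∧ w)                      ≈⟨ ∧-assoc k₁ k₂ w ⟨
    (k₁ ∧ k₂) ∧ w                      ≈⟨ ∧-cong k₁∧k₂≈k₁ Eq.refl ⟩
    k₁ ∧ w                             ∎
    where
    open SetoidReasoning setoid
    k₁∧k₂≈k₁ : k₁ ∧ k₂ ≈ k₁
    k₁∧k₂≈k₁ = antisym (x∧y≤x k₁ k₂) (∧-greatest refl k₁≤k₂)

  restriction : ∀ {k₁ k₂} → k₁ ≤ k₂ → Gal (Down X k₁) (Down X k₂)
  restriction {k₁} {k₂} k₁≤k₂ = record
    { raw = record
      { push = λ u → relᶜ k₂ (proj₁ u) , x∧y≤x _ _
      ; pull = λ v → relᶜ k₁ (proj₁ v) , x∧y≤x _ _ }
    ; push-antitone = relᶜ-antitone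
    ; pull-antitone = relᶜ-antitone
    ; galois = λ u v → relᶜ-galois (proj₂ v) , relᶜ-galois (proj₂ u)
    }

  incl-mono : ∀ {k₁ k₂} → k₁ ≤ k₂ → SubLe X (incl X k₁) (incl X k₂)
  incl-mono k₁≤k₂ =
      restriction k₁≤k₂
    , (λ u → ᶜ-cong (relᶜ-invol (trans (proj₂ u) k₁≤k₂)))
    , (λ z → relᶜ-restrict k₁≤k₂ (z ᶜ))

  incl-cong : ∀ {k₁ k₂} → k₁ ≈ k₂ → SubEq X (incl X k₁) (incl X k₂)
  incl-cong k₁≈k₂ = incl-mono (reflexive k₁≈k₂) , incl-mono (reflexive (Eq.sym k₁≈k₂))

module KernelElements {c ℓ₁ ℓ₂ c' ℓ₁' ℓ₂'} (X : OML c ℓ₁ ℓ₂) (Y : OML c' ℓ₁' ℓ₂')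
                      (f : Gal (obj X) (obj Y)) where
  private
    module X = OML X
    module Y = OML Y

  inv-kernel : ∀ b → kerElt X (coker Y (incl Y b) ∘ᴳ Gal.raw f) X.≈ Gal.pull f (b Y.ᶜ)
  inv-kernel b = antitone-cong Y.poset X.poset (Gal.pull f) (Gal.pull-antitone f)
                               (Y.ᶜ-invol (b Y.ᶜ))

  img-kernel : ∀ a → kerElt Y (coker Y (Gal.raw f ∘ᴳ incl X a)) Y.≈ Gal.push f a Y.ᶜ
  img-kernel a = OrthoLattice.ᶜ-cong Y
    (antitone-cong X.poset Y.poset (Gal.push f) (Gal.push-antitone f) (X.ᶜ-invol a))

lemma3p8 : ∀ {c ℓ₁ ℓ₂ c' ℓ₁' ℓ₂'} (X : OML c ℓ₁ ℓ₂) (Y : OML c' ℓ₁' ℓ₂')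
    (f : Gal (obj X) (obj Y)) (a : OML.Carrier X) (b : OML.Carrier Y) →
    SubEq X (inv X Y (Gal.raw f) (incl Y b))
    (incl X (Gal.pull f (OML._ᶜ Y b)))
    × SubEq Y (img X Y (Gal.raw f) (incl X a))
    (incl Y (OML._ᶜ Y (Gal.push f a)))
lemma3p8 X Y f a b =
    OrthoLattice.incl-cong X (inv-kernel b)
  , OrthoLattice.incl-cong Y (img-kernel a)
  where open KernelElements X Y f
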